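{- Let $S$ be a $(v,k,\mu)$ sum set in a finite group $G$ of order $v$, and let $n = k^2 - \mu v$. Then for every integer $m \ge 1$, in the integral group ring $\mathbb{Z}G$, \[ S^{2m+1} = \frac{k}{v}\left(k^{2m} - n^m\right) G + n^m S. \]
   Context: For $a \in G$, the number of ways to write $a$ as a product in $S$ is the number of ordered pairs $(x,y) \in S\times S$ with $xy = a$. $S$ with $|S|=k$ is a $(v,k,\mu)$ sum set if every nonidentity element of $G$ can be written as a product in $S$ in exactly $\mu$ ways. In $\mathbb{Z}G$, a subset $X \subseteq G$ is identified with the element $\sum_{g\in X} g$ (so $G$ denotes $\sum_{g \in G} g$), an integer $c$ is identified with $c\cdot 1_G$, and $S^{j}$ denotes the $j$-th power of $S$ in the ring $\mathbb{Z}G$. -}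

module Defs where

open import Level using (0ℓ)
open import Data.Nat as ℕ using (ℕ; zero; suc)
open import Data.Integer as ℤ using (ℤ; +_; 0ℤ; 1ℤ)
open import Data.Fin using (Fin; zero; suc)
open import Data.Fin.Properties using (_≟_)
open import Data.Fin.Subset using (Subset; _∈_; ∣_∣)
open import Data.Fin.Subset.Properties using (_∈?_)
open import Data.Bool using (Bool; true; false; if_then_else_)
open import Relation.Nullary using (does)
open import Relation.Binary.PropositionalEquality using (_≡_)
open import Algebra.Structures using (IsGroup)

-- A finite group of order v: carrier Fin v, propositional equality.
-- (Every finite group of order v is isomorphic to such a one.)
record FinGroup (v : ℕ) : Set where
  field
    _∙_     : Fin v → Fin v → Fin v
    e       : Fin v
    _⁻¹     : Fin v → Fin v
    isGroup : IsGroup _≡_ _∙_ e _⁻¹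

ΣFin : (n : ℕ) → (Fin n → ℤ) → ℤ
ΣFin zero    f = 0ℤ
ΣFin (suc n) f = f zero ℤ.+ ΣFin n (λ i → f (suc i))

ΣFinℕ : (n : ℕ) → (Fin n → ℕ) → ℕ
ΣFinℕ zero    f = 0
ΣFinℕ (suc n) f = f zero ℕ.+ ΣFinℕ n (λ i → f (suc i))

χ : Bool → ℕ
χ true  = 1
χ false = 0

module _ {v : ℕ} (G : FinGroup v) where
  open FinGroup G

  reps : Subset v → Fin v → ℕ
  reps S a = ΣFinℕ v λ x → ΣFinℕ v λ y →
    χ (does (x ∈? S) Data.Bool.∧ does (y ∈? S) Data.Bool.∧ does ((x ∙ y) ≟ a))

  IsSumSet : Subset v → ℕ → ℕ → Set
  IsSumSet S k μ = (∣ S ∣ ≡ k) × (∀ a → ¬ (a ≡ e) → reps S a ≡ μ)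
    where
      open import Data.Product using (_×_)
      open import Relation.Nullary using (¬_)

  ℤG : Set
  ℤG = Fin v → ℤ

  _·_ : ℤG → ℤG → ℤG
  (f · g) a = ΣFin v λ x → f x ℤ.* g ((x ⁻¹) ∙ a)

  one : ℤG
  one a = if does (a ≟ e) then 1ℤ else 0ℤ

  _^ᴳ_ : ℤG → ℕ → ℤG
  f ^ᴳ zero  = one
  f ^ᴳ suc j = f · (f ^ᴳ j)

  ⟦_⟧ : Subset v → ℤG
  ⟦ X ⟧ a = if does (a ∈? X) then 1ℤ else 0ℤ

  𝔾 : ℤG
  𝔾 a = 1ℤ

  _+ᴳ_ : ℤG → ℤG → ℤG
  (f +ᴳ g) a = f a ℤ.+ g a

  _•_ : ℤ → ℤG → ℤG
  (c • f) a = c ℤ.* f a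

  _≈ᴳ_ : ℤG → ℤG → Set
  f ≈ᴳ g = ∀ a → f a ≡ g a

module Submission where

open import Defs
open import Data.Nat using (ℕ; _≥_)
open import Data.Integer using (ℤ; +_; _-_; _*_; _^_)
open import Data.Fin.Subset using (Subset)
open import Data.Product using (Σ; _×_)
open import Relation.Binary.PropositionalEquality using (_≡_)

open import Level using (0ℓ)
open import Data.Nat as ℕ using (zero; suc)
import Data.Nat.Properties as ℕP
open import Data.Integer using (0ℤ; 1ℤ; _+_)
import Data.Integer.Properties as ℤP
open import Data.Integer.Tactic.RingSolver using (solve-∀)
open import Data.Fin using (Fin; zero; suc)
open import Data.Fin.Properties using (_≟_)
open import Data.Fin.Permutation using (permutation)
open import Data.Fin.Subset using (∣_∣)
open import Data.Fin.Subset.Properties using (_∈?_)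
open import Data.Bool using (true; false; if_then_else_; _∧_)
open import Data.Vec using ([]; _∷_)
open import Data.Product using (_,_; proj₁; proj₂)
open import Function using (_∘_; _⇔_; mk⇔; Equivalence)
open import Relation.Nullary using (Dec; yes; no; does; ¬_; contradiction)
open import Relation.Binary.PropositionalEquality
  using (refl; sym; trans; cong; cong₂; _≗_; _→-setoid_; module ≡-Reasoning)
open import Algebra.Bundles using (Group)
open import Algebra.Structures using (IsGroup)
import Relation.Binary.Reasoning.Setoid
open import Algebra.Properties.Semiring.Sum ℤP.+-*-semiring
  using (sum; sum-cong-≗; sum-replicate-zero; ∑-distrib-+; ∑-comm; sum-permute; *-distribˡ-sum; *-distribʳ-sum)

-- Write s for the indicator of S in ℤG. The sum-set condition fixes every
-- coefficient of s² except the one at the identity, and that one is forced by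
-- the augmentation (sum of coefficients), which is multiplicative since left
-- translation permutes G: k² = vμ + (s²(e) − μ). Hence s² = μG + n·1. As s·G = kG,
-- multiplying s^(2m+1) = qG + nᵐs by s twice gives s^(2m+3) = (qk + nᵐμ)k·G + nᵐ⁺¹s,
-- and the new coefficient q' satisfies v·q' = k(k^(2m+2) − nᵐ⁺¹) because n = k² − μv.

ΣFin≡sum : ∀ n (f : Fin n → ℤ) → ΣFin n f ≡ sum f
ΣFin≡sum zero    f = refl
ΣFin≡sum (suc n) f = cong (_+_ (f zero)) (ΣFin≡sum n (f ∘ suc))

+ΣFinℕ≡sum : ∀ n (f : Fin n → ℕ) → + ΣFinℕ n f ≡ sum (λ i → + f i)
+ΣFinℕ≡sum zero    f = refl
+ΣFinℕ≡sum (suc n) f = cong (_+_ (+ f zero)) (+ΣFinℕ≡sum n (f ∘ suc))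

sum-const : ∀ n (c : ℤ) → sum {n} (λ _ → c) ≡ + n * c
sum-const zero    c = refl
sum-const (suc n) c = trans (cong (_+_ c) (sum-const n c)) (sym (ℤP.suc-* (+ n) c))

𝟙 : {A : Set} → Dec A → ℤ
𝟙 d = if does d then 1ℤ else 0ℤ

𝟙-cong : {A B : Set} (a? : Dec A) (b? : Dec B) → A ⇔ B → 𝟙 a? ≡ 𝟙 b?
𝟙-cong (yes _) (yes _) _   = refl
𝟙-cong (yes a) (no ¬b) A⇔B = contradiction (Equivalence.to A⇔B a) ¬b
𝟙-cong (no ¬a) (yes b) A⇔B = contradiction (Equivalence.from A⇔B b) ¬a
𝟙-cong (no _)  (no _)  _   = refl

+χ-does : {A : Set} (a? : Dec A) → + χ (does a?) ≡ 𝟙 a?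
+χ-does (yes _) = refl
+χ-does (no _)  = refl

+χ-∧ : ∀ b c → + χ (b ∧ c) ≡ + χ b * + χ c
+χ-∧ true  c = sym (ℤP.*-identityˡ (+ χ c))
+χ-∧ false c = refl

sum-select : ∀ {n} (f : Fin n → ℤ) (z : Fin n) → sum (λ y → f y * 𝟙 (y ≟ z)) ≡ f z
sum-select {suc n} f zero = begin
  f zero * 1ℤ + sum (λ i → f (suc i) * 0ℤ) ≡⟨ cong₂ _+_ (ℤP.*-identityʳ (f zero)) (sum-cong-≗ (ℤP.*-zeroʳ ∘ f ∘ suc)) ⟩
  f zero + sum {n} (λ _ → 0ℤ)             ≡⟨ cong (_+_ (f zero)) (sum-replicate-zero n) ⟩
  f zero + 0ℤ                             ≡⟨ ℤP.+-identityʳ (f zero) ⟩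
  f zero                                  ∎
  where open ≡-Reasoning
sum-select {suc n} f (suc z) = begin
  f zero * 0ℤ + sum (λ i → f (suc i) * 𝟙 (i ≟ z)) ≡⟨ cong (_+ sum (λ i → f (suc i) * 𝟙 (i ≟ z))) (ℤP.*-zeroʳ (f zero)) ⟩
  0ℤ + sum (λ i → f (suc i) * 𝟙 (i ≟ z))          ≡⟨ ℤP.+-identityˡ _ ⟩
  sum (λ i → f (suc i) * 𝟙 (i ≟ z))               ≡⟨ sum-select (f ∘ suc) z ⟩
  f (suc z)                                        ∎
  where open ≡-Reasoning

sum-⟦⟧ : ∀ {n} (X : Subset n) → sum (λ a → 𝟙 (a ∈? X)) ≡ + ∣ X ∣
sum-⟦⟧ {zero}  []          = refl
sum-⟦⟧ {suc n} (true  ∷ X) = cong (_+_ 1ℤ) (sum-⟦⟧ X)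
sum-⟦⟧ {suc n} (false ∷ X) = trans (ℤP.+-identityˡ _) (sum-⟦⟧ X)

module GroupRing {v : ℕ} (G : FinGroup v) where
  open FinGroup G
  -- x \\ a unfolds to x ⁻¹ ∙ a, the argument used in the definition of _·_.
  open IsGroup isGroup using (_\\_; identityʳ; inverseˡ)

  infixl 7 _⋆_
  infixr 7 _⊙_
  infixl 6 _⊕_

  _⋆_ : ℤG G → ℤG G → ℤG G
  _⋆_ = _·_ G

  _⊙_ : ℤ → ℤG G → ℤG G
  _⊙_ = _•_ G

  _⊕_ : ℤG G → ℤG G → ℤG G
  _⊕_ = _+ᴳ_ G

  group : Group 0ℓ 0ℓ
  group = record { isGroup = isGroup }

  open import Algebra.Properties.Group group using (y≈x\\z; \\-leftDividesˡ; \\-leftDividesʳ)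

  ∙≡⇔≡\\ : ∀ x y a → (x ∙ y ≡ a) ⇔ (y ≡ x \\ a)
  ∙≡⇔≡\\ x y a = mk⇔ (y≈x\\z x y a) (λ { refl → \\-leftDividesˡ x a })

  \\≡e⇔≡ : ∀ x a → (x \\ a ≡ e) ⇔ (x ≡ a)
  \\≡e⇔≡ x a = mk⇔ (λ x\\a≡e → trans (sym (identityʳ x)) (Equivalence.from (∙≡⇔≡\\ x e a) (sym x\\a≡e)))
                   (λ { refl → inverseˡ x })

  ⋆-sum : ∀ f g a → (f ⋆ g) a ≡ sum (λ x → f x * g (x \\ a))
  ⋆-sum f g a = ΣFin≡sum v _

  sum-translate : ∀ x (g : ℤG G) → sum (λ a → g (x \\ a)) ≡ sum g
  sum-translate x g = sym (sum-permute g (permutation (x \\_) (x ∙_) (\\-leftDividesʳ x) (\\-leftDividesˡ x)))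

  sum-⋆ : ∀ f g → sum (f ⋆ g) ≡ sum f * sum g
  sum-⋆ f g = begin
    sum (f ⋆ g)                                ≡⟨ sum-cong-≗ (⋆-sum f g) ⟩
    sum (λ a → sum (λ x → f x * g (x \\ a)))   ≡⟨ ∑-comm (λ a x → f x * g (x \\ a)) ⟩
    sum (λ x → sum (λ a → f x * g (x \\ a)))   ≡⟨ sum-cong-≗ (λ x → sym (*-distribˡ-sum (f x) (λ a → g (x \\ a)))) ⟩
    sum (λ x → f x * sum (λ a → g (x \\ a)))   ≡⟨ sum-cong-≗ (λ x → cong (f x *_) (sum-translate x g)) ⟩
    sum (λ x → f x * sum g)                    ≡⟨ *-distribʳ-sum (sum g) f ⟨
    sum f * sum g                              ∎
    where open ≡-Reasoning

  ⋆-congˡ : ∀ f {g h} → g ≗ h → f ⋆ g ≗ f ⋆ h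
  ⋆-congˡ f {g} {h} g≗h a = begin
    (f ⋆ g) a                       ≡⟨ ⋆-sum f g a ⟩
    sum (λ x → f x * g (x \\ a))    ≡⟨ sum-cong-≗ (λ x → cong (f x *_) (g≗h (x \\ a))) ⟩
    sum (λ x → f x * h (x \\ a))    ≡⟨ sym (⋆-sum f h a) ⟩
    (f ⋆ h) a                       ∎
    where open ≡-Reasoning

  ⋆-identityʳ : ∀ f → f ⋆ one G ≗ f
  ⋆-identityʳ f a = begin
    (f ⋆ one G) a                       ≡⟨ ⋆-sum f (one G) a ⟩
    sum (λ x → f x * 𝟙 (x \\ a ≟ e))    ≡⟨ sum-cong-≗ (λ x → cong (f x *_) (𝟙-cong (x \\ a ≟ e) (x ≟ a) (\\≡e⇔≡ x a))) ⟩
    sum (λ x → f x * 𝟙 (x ≟ a))         ≡⟨ sum-select f a ⟩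
    f a                                 ∎
    where open ≡-Reasoning

  ⋆-affine : ∀ f h c d → f ⋆ (c ⊙ 𝔾 G ⊕ d ⊙ h) ≗ (c * sum f) ⊙ 𝔾 G ⊕ d ⊙ (f ⋆ h)
  ⋆-affine f h c d a = begin
    (f ⋆ (c ⊙ 𝔾 G ⊕ d ⊙ h)) a                                ≡⟨ ⋆-sum f (c ⊙ 𝔾 G ⊕ d ⊙ h) a ⟩
    sum (λ x → f x * (c * 1ℤ + d * h (x \\ a)))               ≡⟨ sum-cong-≗ (λ x → expand c d (f x) (h (x \\ a))) ⟩
    sum (λ x → c * f x + d * (f x * h (x \\ a)))              ≡⟨ ∑-distrib-+ (λ x → c * f x) (λ x → d * (f x * h (x \\ a))) ⟩
    sum (λ x → c * f x) + sum (λ x → d * (f x * h (x \\ a)))  ≡⟨ cong₂ _+_ (*-distribˡ-sum c f) (*-distribˡ-sum d (λ x → f x * h (x \\ a))) ⟨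
    c * sum f + d * sum (λ x → f x * h (x \\ a))              ≡⟨ cong (λ t → c * sum f + d * t) (sym (⋆-sum f h a)) ⟩
    c * sum f + d * (f ⋆ h) a                                 ≡⟨ cong (_+ d * (f ⋆ h) a) (sym (ℤP.*-identityʳ (c * sum f))) ⟩
    c * sum f * 1ℤ + d * (f ⋆ h) a                            ∎
    where
      open ≡-Reasoning
      expand : ∀ p q y z → y * (p * 1ℤ + q * z) ≡ p * y + q * (y * z)
      expand = solve-∀

quotient-recurrence : ∀ v k μ q K N → v * q ≡ k * (K - N) →
  v * ((q * k + N * μ) * k) ≡ k * (k * (k * K) - (k * k - μ * v) * N)
quotient-recurrence v k μ q K N vq≡ = begin
  v * ((q * k + N * μ) * k)                ≡⟨ expand v k μ q N ⟩
  (v * q) * k * k + N * μ * v * k          ≡⟨ cong (λ t → t * k * k + N * μ * v * k) vq≡ ⟩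
  k * (K - N) * k * k + N * μ * v * k      ≡⟨ collect v k μ K N ⟩
  k * (k * (k * K) - (k * k - μ * v) * N)  ∎
  where
    open ≡-Reasoning
    expand : ∀ v k μ q N → v * ((q * k + N * μ) * k) ≡ (v * q) * k * k + N * μ * v * k
    expand = solve-∀
    collect : ∀ v k μ K N → k * (K - N) * k * k + N * μ * v * k ≡ k * (k * (k * K) - (k * k - μ * v) * N)
    collect = solve-∀

module SumSetPowers {v : ℕ} (G : FinGroup v) {S : Subset v} {k μ : ℕ} (sumSet : IsSumSet G S k μ) where
  open FinGroup G
  open IsGroup isGroup using (_\\_)
  open GroupRing G
  module ≗-Reasoning = Relation.Binary.Reasoning.Setoid (Fin v →-setoid ℤ)

  s : ℤG G
  s = ⟦_⟧ G S

  n : ℤ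
  n = + k * + k - + μ * + v

  sum-s : sum s ≡ + k
  sum-s = trans (sum-⟦⟧ S) (cong +_ (proj₁ sumSet))

  reps≡s⋆s : ∀ a → + reps G S a ≡ (s ⋆ s) a
  reps≡s⋆s a = begin
    + reps G S a                          ≡⟨ +ΣFinℕ≡sum v _ ⟩
    sum (λ x → + ΣFinℕ v (λ y → pair x y)) ≡⟨ sum-cong-≗ (λ x → trans (+ΣFinℕ≡sum v (pair x)) (pairs-from x)) ⟩
    sum (λ x → s x * s (x \\ a))          ≡⟨ ⋆-sum s s a ⟨
    (s ⋆ s) a                             ∎
    where
      open ≡-Reasoning
      pair : Fin v → Fin v → ℕ
      pair x y = χ (does (x ∈? S) ∧ does (y ∈? S) ∧ does (x ∙ y ≟ a))
      pair≡ : ∀ x y → + pair x y ≡ s x * (s y * 𝟙 (y ≟ x \\ a))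
      pair≡ x y = begin
        + pair x y
          ≡⟨ +χ-∧ (does (x ∈? S)) (does (y ∈? S) ∧ does (x ∙ y ≟ a)) ⟩
        + χ (does (x ∈? S)) * + χ (does (y ∈? S) ∧ does (x ∙ y ≟ a))
          ≡⟨ cong₂ _*_ (+χ-does (x ∈? S)) (+χ-∧ (does (y ∈? S)) (does (x ∙ y ≟ a))) ⟩
        s x * (+ χ (does (y ∈? S)) * + χ (does (x ∙ y ≟ a)))
          ≡⟨ cong (s x *_) (cong₂ _*_ (+χ-does (y ∈? S)) (+χ-does (x ∙ y ≟ a))) ⟩
        s x * (s y * 𝟙 (x ∙ y ≟ a))
          ≡⟨ cong (λ t → s x * (s y * t)) (𝟙-cong (x ∙ y ≟ a) (y ≟ x \\ a) (∙≡⇔≡\\ x y a)) ⟩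
        s x * (s y * 𝟙 (y ≟ x \\ a))
          ∎
      pairs-from : ∀ x → sum (λ y → + pair x y) ≡ s x * s (x \\ a)
      pairs-from x = begin
        sum (λ y → + pair x y)                    ≡⟨ sum-cong-≗ (pair≡ x) ⟩
        sum (λ y → s x * (s y * 𝟙 (y ≟ x \\ a)))  ≡⟨ *-distribˡ-sum (s x) (λ y → s y * 𝟙 (y ≟ x \\ a)) ⟨
        s x * sum (λ y → s y * 𝟙 (y ≟ x \\ a))    ≡⟨ cong (s x *_) (sum-select s (x \\ a)) ⟩
        s x * s (x \\ a)                          ∎

  s⋆s-off-identity : ∀ a → ¬ a ≡ e → (s ⋆ s) a ≡ + μ
  s⋆s-off-identity a a≢e = trans (sym (reps≡s⋆s a)) (cong +_ (proj₂ sumSet a a≢e))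

  s⋆s-shape : ∀ a → (s ⋆ s) a ≡ + μ + ((s ⋆ s) e - + μ) * 𝟙 (a ≟ e)
  s⋆s-shape a with a ≟ e
  ... | yes refl = shape₁ ((s ⋆ s) e) (+ μ)
    where
      shape₁ : ∀ r μ → r ≡ μ + (r - μ) * 1ℤ
      shape₁ = solve-∀
  ... | no a≢e   = trans (s⋆s-off-identity a a≢e) (shape₀ ((s ⋆ s) e) (+ μ))
    where
      shape₀ : ∀ r μ → μ ≡ μ + (r - μ) * 0ℤ
      shape₀ = solve-∀

  s⋆s-at-identity : (s ⋆ s) e - + μ ≡ n
  s⋆s-at-identity = begin
    (s ⋆ s) e - + μ                          ≡⟨ isolate (+ v) (+ μ) ((s ⋆ s) e - + μ) ⟩
    (+ v * + μ + ((s ⋆ s) e - + μ)) - + μ * + v ≡⟨ cong (_- + μ * + v) total ⟨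
    n                                        ∎
    where
      open ≡-Reasoning
      isolate : ∀ v μ y → y ≡ (v * μ + y) - μ * v
      isolate = solve-∀
      total : + k * + k ≡ + v * + μ + ((s ⋆ s) e - + μ)
      total = begin
        + k * + k                                          ≡⟨ cong₂ _*_ sum-s sum-s ⟨
        sum s * sum s                                      ≡⟨ sum-⋆ s s ⟨
        sum (s ⋆ s)                                        ≡⟨ sum-cong-≗ s⋆s-shape ⟩
        sum (λ a → + μ + ((s ⋆ s) e - + μ) * 𝟙 (a ≟ e))     ≡⟨ ∑-distrib-+ (λ _ → + μ) (λ a → ((s ⋆ s) e - + μ) * 𝟙 (a ≟ e)) ⟩
        sum {v} (λ _ → + μ) + sum (λ a → ((s ⋆ s) e - + μ) * 𝟙 (a ≟ e))
          ≡⟨ cong₂ _+_ (sum-const v (+ μ)) (sum-select (λ _ → (s ⋆ s) e - + μ) e) ⟩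
        + v * + μ + ((s ⋆ s) e - + μ)                       ∎

  s⋆s≗μ⊙𝔾⊕n⊙one : s ⋆ s ≗ + μ ⊙ 𝔾 G ⊕ n ⊙ one G
  s⋆s≗μ⊙𝔾⊕n⊙one a = begin
    (s ⋆ s) a                                  ≡⟨ s⋆s-shape a ⟩
    + μ + ((s ⋆ s) e - + μ) * 𝟙 (a ≟ e)         ≡⟨ cong₂ (λ x y → x + y * 𝟙 (a ≟ e)) (sym (ℤP.*-identityʳ (+ μ))) s⋆s-at-identity ⟩
    + μ * 1ℤ + n * 𝟙 (a ≟ e)                    ∎
    where open ≡-Reasoning

  odd-power : ∀ m → Σ ℤ λ q → (+ v * q ≡ + k * ((+ k) ^ (2 ℕ.* m) - n ^ m))
                             × (_^ᴳ_ G s (2 ℕ.* m ℕ.+ 1) ≗ q ⊙ 𝔾 G ⊕ n ^ m ⊙ s)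
  odd-power zero = 0ℤ , trans (ℤP.*-zeroʳ (+ v)) (sym (ℤP.*-zeroʳ (+ k))) , base
    where
      base : s ⋆ one G ≗ 0ℤ ⊙ 𝔾 G ⊕ 1ℤ ⊙ s
      base a = trans (⋆-identityʳ s a) (sym (trans (ℤP.+-identityˡ (1ℤ * s a)) (ℤP.*-identityˡ (s a))))
  odd-power (suc m) with odd-power m
  ... | q , vq≡ , s^≗ = c * + k , vq′≡ , power
    where
      N = n ^ m
      c = q * + k + N * + μ
      2+2m : 2 ℕ.* suc m ≡ suc (suc (2 ℕ.* m))
      2+2m = ℕP.*-suc 2 m

      vq′≡ : + v * (c * + k) ≡ + k * ((+ k) ^ (2 ℕ.* suc m) - n * N)
      vq′≡ = trans (quotient-recurrence (+ v) (+ k) (+ μ) q ((+ k) ^ (2 ℕ.* m)) N vq≡)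
                   (cong (λ j → + k * ((+ k) ^ j - n * N)) (sym 2+2m))

      collect : (q * sum s) ⊙ 𝔾 G ⊕ N ⊙ (s ⋆ s) ≗ c ⊙ 𝔾 G ⊕ (n * N) ⊙ one G
      collect a = begin
        q * sum s * 1ℤ + N * (s ⋆ s) a             ≡⟨ cong₂ (λ x y → q * x * 1ℤ + N * y) sum-s (s⋆s≗μ⊙𝔾⊕n⊙one a) ⟩
        q * + k * 1ℤ + N * (+ μ * 1ℤ + n * one G a) ≡⟨ regroup q (+ k) N (+ μ) n (one G a) ⟩
        c * 1ℤ + n * N * one G a                   ∎
        where
          open ≡-Reasoning
          regroup : ∀ q k N μ n o → q * k * 1ℤ + N * (μ * 1ℤ + n * o) ≡ (q * k + N * μ) * 1ℤ + n * N * o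
          regroup = solve-∀

      power : _^ᴳ_ G s (2 ℕ.* suc m ℕ.+ 1) ≗ (c * + k) ⊙ 𝔾 G ⊕ (n * N) ⊙ s
      power = begin
        _^ᴳ_ G s (2 ℕ.* suc m ℕ.+ 1)                ≡⟨ cong (λ j → _^ᴳ_ G s (j ℕ.+ 1)) 2+2m ⟩
        s ⋆ (s ⋆ _^ᴳ_ G s (2 ℕ.* m ℕ.+ 1))           ≈⟨ ⋆-congˡ s (⋆-congˡ s s^≗) ⟩
        s ⋆ (s ⋆ (q ⊙ 𝔾 G ⊕ N ⊙ s))                 ≈⟨ ⋆-congˡ s (⋆-affine s s q N) ⟩
        s ⋆ ((q * sum s) ⊙ 𝔾 G ⊕ N ⊙ (s ⋆ s))        ≈⟨ ⋆-congˡ s collect ⟩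
        s ⋆ (c ⊙ 𝔾 G ⊕ (n * N) ⊙ one G)             ≈⟨ ⋆-affine s (one G) c (n * N) ⟩
        (c * sum s) ⊙ 𝔾 G ⊕ (n * N) ⊙ (s ⋆ one G)   ≈⟨ (λ a → cong₂ (λ x y → c * x * 1ℤ + n * N * y) sum-s (⋆-identityʳ s a)) ⟩
        (c * + k) ⊙ 𝔾 G ⊕ (n * N) ⊙ s               ∎
        where open ≗-Reasoning

corollary4p2 : (v : ℕ) (G : FinGroup v) (S : Subset v) (k μ : ℕ) →
    IsSumSet G S k μ →
    (m : ℕ) → m ≥ 1 →
    let n = (+ k) * (+ k) - (+ μ) * (+ v) in
    Σ ℤ (λ q → ((+ v) * q ≡ (+ k) * ((+ k) ^ (2 Data.Nat.* m) - n ^ m))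
    × _≈ᴳ_ G (_^ᴳ_ G (⟦_⟧ G S) (2 Data.Nat.* m Data.Nat.+ 1))
    (_+ᴳ_ G (_•_ G q (𝔾 G)) (_•_ G (n ^ m) (⟦_⟧ G S))))
-- The identity also holds for m = 0.
corollary4p2 v G S k μ sumSet m _ = SumSetPowers.odd-power G sumSet m
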